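{- For every $n\ge1$, $\mathsf{gran}(\mathrm{MAJ}_n)=n-\mathsf{B}(n)$.
   Context: $\mathrm{MAJ}_n\colon\{0,1\}^n\to\{ -1,1\}$ is defined by $\mathrm{MAJ}_n(x)=-1$ iff $\sum_{i=1}^n x_i\ge n/2$. $\mathsf{B}(n)$ is the number of ones in the binary representation of $n$. For $S\subseteq[n]$, $\widehat{f}(S)=2^{ -n}\sum_{x}f(x)\prod_{i\in S}(-1)^{x_i}$. For a rational $\alpha$ whose denominator is a power of $2$, $\mathsf{gran}(\alpha)$ is the minimal integer $k\ge0$ with $2^k\alpha\in\mathbb{Z}$; $\mathsf{gran}(f)=\max_{S\subseteq[n]}\mathsf{gran}(\widehat{f}(S))$. -}

module Defs where

open import Data.Bool using (Bool; true; false; if_then_else_; _∧_)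
open import Data.Nat as ℕ using (ℕ; zero; suc; _≤_; _<_)
open import Data.Nat.Properties using (m^n≢0)
open import Data.Nat.DivMod using (_/_; _%_)
open import Data.Integer as ℤ using (ℤ; +_)
open import Data.Rational as ℚ using (ℚ)
open import Data.Vec using (Vec; []; _∷_)
open import Data.List using (List; []; _∷_; map; _++_; foldr)
open import Data.Product using (Σ; ∃; _×_)
open import Relation.Binary.PropositionalEquality using (_≡_)
open import Relation.Nullary using (¬_)

-- Inputs x ∈ {0,1}^n as Vec Bool n (true = 1); subsets S ⊆ [n] as
-- indicator vectors Vec Bool n (true = i ∈ S).

allVecs : (n : ℕ) → List (Vec Bool n)
allVecs zero = [] ∷ []
allVecs (suc n) = map (false ∷_) (allVecs n) ++ map (true ∷_) (allVecs n)

weight : {n : ℕ} → Vec Bool n → ℕ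
weight [] = 0
weight (false ∷ x) = weight x
weight (true ∷ x) = suc (weight x)

MAJ : (n : ℕ) → Vec Bool n → ℤ
MAJ n x with n ℕ.≤? 2 ℕ.* weight x
... | Relation.Nullary.yes _ = ℤ.-[1+ 0 ]
... | Relation.Nullary.no _ = + 1

χ : {n : ℕ} → Vec Bool n → Vec Bool n → ℤ
χ [] [] = + 1
χ (s ∷ S) (b ∷ x) = (if s ∧ b then ℤ.-[1+ 0 ] else + 1) ℤ.* χ S x

sumℤ : List ℤ → ℤ
sumℤ = foldr ℤ._+_ (+ 0)

fourier : (n : ℕ) → (Vec Bool n → ℤ) → Vec Bool n → ℚ
fourier n f S =
  (sumℤ (map (λ x → f x ℤ.* χ S x) (allVecs n)) ℚ./ (2 ℕ.^ n))
    {{m^n≢0 2 n}}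

IsInteger : ℚ → Set
IsInteger α = ∃ λ (z : ℤ) → α ≡ (z ℚ./ 1)

IsGran : ℚ → ℕ → Set
IsGran α k =
  IsInteger ((+ (2 ℕ.^ k) ℚ./ 1) ℚ.* α)
  × (∀ j → j < k → ¬ IsInteger ((+ (2 ℕ.^ j) ℚ./ 1) ℚ.* α))

IsGranF : (n : ℕ) → (Vec Bool n → ℤ) → ℕ → Set
IsGranF n f k =
  (∀ (S : Vec Bool n) → Σ ℕ λ j → IsGran (fourier n f S) j × j ≤ k)
  × (Σ (Vec Bool n) λ S → IsGran (fourier n f S) k)

-- B(n): number of ones in the binary representation of n
-- (fuel-based; fuel n suffices since n/2 < n for n ≥ 1).
popcountAux : ℕ → ℕ → ℕ
popcountAux zero _ = 0
popcountAux (suc fuel) m = (m % 2) ℕ.+ popcountAux fuel (m / 2)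

B : ℕ → ℕ
B n = popcountAux n n

module Submission where

-- Write A(S) = 2^n · MAJ^(S) ∈ ℤ. When A(S) ≠ 0 its granularity is n − v₂(A(S)), so it suffices
-- that 2^B(n) divides every A(S), with equality of 2-adic valuations for S = {1}.
-- Flipping a coordinate i ∈ S shows A(S) = 2 · [t^(⌈n/2⌉-1)] (1 + t)^(n - |S|) (1 - t)^(|S| - 1).
-- Expanding 1 + t = (1 - t) + 2t makes this a ℤ-combination of the numbers 2^(a+1) C(u + v, u)
-- with a + u = ⌈n/2⌉ - 1 and a + u + v = n - 1, each divisible by 2^B(n) by Kummer's theorem
-- v₂ C(x + y, x) = B(x) + B(y) - B(x + y) together with the subadditivity of B.
-- For S = ∅, A(S) is 0 (n odd) or -C(n, n/2) (n even); for S = {1}, A(S) = 2 C(n - 1, ⌊(n-1)/2⌋),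
-- whose valuation is exactly B(n), again by Kummer's theorem.

open import Defs
open import Data.Nat using (ℕ; _≤_; _∸_)

module TwoAdic where
  open import Data.Nat
  open import Data.Nat.Properties
  open import Data.Nat.DivMod
  open import Data.Nat.Divisibility
  open import Data.Nat.Primality using (Prime; prime?; euclidsLemma)
  open import Data.Nat.Binary.Base as Bin using (2[1+_]; 1+[2_])
  open import Data.Nat.Binary.Properties using (toℕ-fromℕ)
  open import Data.Nat.Tactic.RingSolver using (solve-∀)
  open import Data.Product using (∃; _×_; _,_)
  open import Data.Sum using ([_,_])
  open import Data.Empty using (⊥-elim)
  open import Relation.Nullary using (¬_)
  open import Relation.Nullary.Decidable using (from-yes)
  open import Relation.Binary.PropositionalEquality hiding ([_])

  binary-induction : (P : ℕ → Set) → P 0 → (∀ n → P n → P (2 * suc n)) →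
                     (∀ n → P n → P (suc (2 * n))) → ∀ n → P n
  binary-induction P P0 P-even P-odd n = subst P (toℕ-fromℕ n) (go (Bin.fromℕ n))
    where
    go : ∀ b → P (Bin.toℕ b)
    go Bin.zero = P0
    go 2[1+ b ] = P-even _ (go b)
    go 1+[2 b ] = P-odd _ (go b)

  popcountAux-zero : ∀ f → popcountAux f 0 ≡ 0
  popcountAux-zero zero    = refl
  popcountAux-zero (suc f) = popcountAux-zero f

  half≤ : ∀ {m k} → m ≤ suc k → m / 2 ≤ k
  half≤ {zero}  _   = z≤n
  half≤ {suc m} m≤k = ≤-pred (≤-trans (m/n<m (suc m) 2 (s≤s (s≤s z≤n))) m≤k)

  popcountAux-fuel : ∀ f g {m} → m ≤ f → m ≤ g → popcountAux f m ≡ popcountAux g m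
  popcountAux-fuel zero    g       z≤n _   = sym (popcountAux-zero g)
  popcountAux-fuel (suc f) zero    _   z≤n = popcountAux-zero (suc f)
  popcountAux-fuel (suc f) (suc g) {m} m≤f m≤g =
    cong (m % 2 +_) (popcountAux-fuel f g (half≤ m≤f) (half≤ m≤g))

  B-double : ∀ n → B (2 * n) ≡ B n
  B-double zero    = refl
  B-double (suc n) = begin
    (2 * suc n) % 2 + popcountAux (n + suc (n + 0)) ((2 * suc n) / 2)
      ≡⟨ cong₂ _+_ (trans (cong (_% 2) (*-comm 2 (suc n))) (m*n%n≡0 (suc n) 2))
                   (cong (popcountAux (n + suc (n + 0))) (trans (cong (_/ 2) (*-comm 2 (suc n))) (m*n/n≡m (suc n) 2))) ⟩
    popcountAux (n + suc (n + 0)) (suc n)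
      ≡⟨ popcountAux-fuel (n + suc (n + 0)) (suc n) (≤-trans (s≤s (m≤m+n n (n + 0))) (≤-reflexive (sym (+-suc n (n + 0))))) ≤-refl ⟩
    B (suc n) ∎
    where open ≡-Reasoning

  B-double+1 : ∀ n → B (suc (2 * n)) ≡ suc (B n)
  B-double+1 n = begin
    suc (2 * n) % 2 + popcountAux (2 * n) (suc (2 * n) / 2)
      ≡⟨ cong₂ _+_ (trans (cong (_% 2) 1+2n) ([m+kn]%n≡m%n 1 n 2))
                   (cong (popcountAux (2 * n)) (trans (cong (_/ 2) 1+2n) (+-distrib-/ 1 (n * 2) 1+0<2))) ⟩
    1 + popcountAux (2 * n) (0 + n * 2 / 2)
      ≡⟨ cong (λ m → 1 + popcountAux (2 * n) m) (m*n/n≡m n 2) ⟩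
    1 + popcountAux (2 * n) n
      ≡⟨ cong suc (popcountAux-fuel (2 * n) n (m≤m+n n (n + 0)) ≤-refl) ⟩
    suc (B n) ∎
    where
    open ≡-Reasoning
    1+2n : suc (2 * n) ≡ 1 + n * 2
    1+2n = cong suc (*-comm 2 n)
    1+0<2 : 1 % 2 + (n * 2) % 2 < 2
    1+0<2 = subst (λ r → 1 + r < 2) (sym (m*n%n≡0 n 2)) ≤-refl

  B-2+2* : ∀ n → B (2 + 2 * n) ≡ B (suc n)
  B-2+2* n = trans (cong B (sym (*-suc 2 n))) (B-double (suc n))

  2r+1≡r+[1+r] : ∀ r → suc (2 * r) ≡ r + suc r
  2r+1≡r+[1+r] r = trans (cong (λ x → suc (r + x)) (+-identityʳ r)) (sym (+-suc r r))

  Odd : ℕ → Set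
  Odd o = ¬ 2 ∣ o

  2-prime : Prime 2
  2-prime = from-yes (prime? 2)

  odd-* : ∀ {a b} → Odd a → Odd b → Odd (a * b)
  odd-* {a} {b} a-odd b-odd 2∣ab = [ a-odd , b-odd ] (euclidsLemma a b 2-prime 2∣ab)

  odd-2*+1 : ∀ n → Odd (suc (2 * n))
  odd-2*+1 n (divides q eq) = even≢odd q n (trans (*-comm 2 q) (sym eq))

  2^∣2^*odd⇒≤ : ∀ {o} → Odd o → ∀ k e → 2 ^ k ∣ 2 ^ e * o → k ≤ e
  2^∣2^*odd⇒≤ o-odd zero    e       _ = z≤n
  2^∣2^*odd⇒≤ {o} o-odd (suc k) zero 2^k+1∣o =
    ⊥-elim (o-odd (m*n∣⇒m∣ 2 (2 ^ k) (∣-trans 2^k+1∣o (∣-reflexive (+-identityʳ o)))))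
  2^∣2^*odd⇒≤ {o} o-odd (suc k) (suc e) 2^k+1∣2^e+1o =
    s≤s (2^∣2^*odd⇒≤ o-odd k e (*-cancelˡ-∣ 2 (∣-trans 2^k+1∣2^e+1o (∣-reflexive (*-assoc 2 (2 ^ e) o)))))

  ≤⇒2^∣2^ : ∀ {k e} → k ≤ e → 2 ^ k ∣ 2 ^ e
  ≤⇒2^∣2^ {k} k≤e with m≤n⇒∃[o]m+o≡n k≤e
  ... | d , refl = divides (2 ^ d) (trans (^-distribˡ-+-* 2 k d) (*-comm (2 ^ k) (2 ^ d)))

  record IsVal₂ (x e : ℕ) : Set where
    constructor val₂
    field
      oddPart : ℕ
      oddPart-odd : Odd oddPart
      decomposition : x ≡ 2 ^ e * oddPart

  IsVal₂⇒∣ : ∀ {x e} → IsVal₂ x e → 2 ^ e ∣ x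
  IsVal₂⇒∣ {e = e} (val₂ o _ refl) = divides o (*-comm (2 ^ e) o)

  IsVal₂-maximal : ∀ {x e k} → IsVal₂ x e → 2 ^ k ∣ x → k ≤ e
  IsVal₂-maximal {k = k} (val₂ _ o-odd refl) = 2^∣2^*odd⇒≤ o-odd k _

  IsVal₂-unique : ∀ {x e f} → IsVal₂ x e → IsVal₂ x f → e ≡ f
  IsVal₂-unique v w = ≤-antisym (IsVal₂-maximal w (IsVal₂⇒∣ v)) (IsVal₂-maximal v (IsVal₂⇒∣ w))

  IsVal₂⇒≢0 : ∀ {x e} → IsVal₂ x e → x ≢ 0
  IsVal₂⇒≢0 {e = e} v refl = 1+n≰n (IsVal₂-maximal v (divides 0 refl))

  IsVal₂-odd : ∀ {o} → Odd o → IsVal₂ o 0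
  IsVal₂-odd {o} o-odd = val₂ o o-odd (sym (+-identityʳ o))

  IsVal₂-2^ : ∀ e → IsVal₂ (2 ^ e) e
  IsVal₂-2^ e = val₂ 1 (odd-2*+1 0) (sym (*-identityʳ (2 ^ e)))

  IsVal₂-* : ∀ {x y e f} → IsVal₂ x e → IsVal₂ y f → IsVal₂ (x * y) (e + f)
  IsVal₂-* {e = e} {f} (val₂ o o-odd refl) (val₂ p p-odd refl) =
    val₂ (o * p) (odd-* o-odd p-odd) (begin
      2 ^ e * o * (2 ^ f * p) ≡⟨ [m*n]*[o*p]≡[m*o]*[n*p] (2 ^ e) o (2 ^ f) p ⟩
      2 ^ e * 2 ^ f * (o * p) ≡⟨ cong (_* (o * p)) (^-distribˡ-+-* 2 e f) ⟨
      2 ^ (e + f) * (o * p)   ∎)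
    where open ≡-Reasoning

  IsVal₂-double : ∀ {x e} → IsVal₂ x e → IsVal₂ (2 * x) (suc e)
  IsVal₂-double = IsVal₂-* {2} {e = 1} (val₂ 1 (odd-2*+1 0) refl)

  IsVal₂-suc : ∀ n → ∃ λ e → IsVal₂ (suc n) e × e + B (suc n) ≡ suc (B n)
  IsVal₂-suc = binary-induction Carry (0 , IsVal₂-odd (odd-2*+1 0) , refl) even odd
    where
    Carry : ℕ → Set
    Carry n = ∃ λ e → IsVal₂ (suc n) e × e + B (suc n) ≡ suc (B n)
    even : ∀ n → Carry n → Carry (2 * suc n)
    even n _ = 0 , IsVal₂-odd (odd-2*+1 (suc n)) , trans (B-double+1 (suc n)) (cong suc (sym (B-double (suc n))))
    odd : ∀ n → Carry n → Carry (suc (2 * n))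
    odd n (e , v , eq) = suc e , subst (λ m → IsVal₂ m (suc e) × suc e + B m ≡ suc (B (suc (2 * n)))) (*-suc 2 n)
      (IsVal₂-double v , cong suc (trans (cong (e +_) (B-double (suc n))) (trans eq (sym (B-double+1 n)))))

  IsVal₂-exists : ∀ x → .{{NonZero x}} → ∃ (IsVal₂ x)
  IsVal₂-exists (suc n) with IsVal₂-suc n
  ... | e , v , _ = e , v

  IsVal₂-cancelʳ : ∀ {x y s t} → IsVal₂ (x * y) s → IsVal₂ y t → ∃ λ e → IsVal₂ x e × e + t ≡ s
  IsVal₂-cancelʳ {zero}    vxy _  = ⊥-elim (IsVal₂⇒≢0 vxy refl)
  IsVal₂-cancelʳ {x@(suc _)} vxy vy with IsVal₂-exists x
  ... | e , vx = e , vx , IsVal₂-unique (IsVal₂-* vx vy) vxy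

  legendre : ∀ n → ∃ λ e → IsVal₂ (n !) e × e + B n ≡ n
  legendre zero = 0 , IsVal₂-odd (odd-2*+1 0) , refl
  legendre (suc n) with IsVal₂-suc n | legendre n
  ... | c , vc , hc | e , ve , he = c + e , IsVal₂-* vc ve , (begin
    c + e + B (suc n)   ≡⟨ cong (_+ B (suc n)) (+-comm c e) ⟩
    e + c + B (suc n)   ≡⟨ +-assoc e c (B (suc n)) ⟩
    e + (c + B (suc n)) ≡⟨ cong (e +_) hc ⟩
    e + suc (B n)       ≡⟨ +-suc e (B n) ⟩
    suc (e + B n)       ≡⟨ cong suc he ⟩
    suc n               ∎)
    where open ≡-Reasoning

  -- binom u v = C(u + v, u)
  binom : ℕ → ℕ → ℕ
  binom zero    _       = 1
  binom (suc u) zero    = 1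
  binom (suc u) (suc v) = binom u (suc v) + binom (suc u) v

  binom-zeroʳ : ∀ u → binom u 0 ≡ 1
  binom-zeroʳ zero    = refl
  binom-zeroʳ (suc u) = refl

  binom-*-! : ∀ u v → binom u v * (u ! * v !) ≡ (u + v) !
  binom-*-! zero    v       = trans (+-identityʳ (v ! + 0)) (+-identityʳ (v !))
  binom-*-! (suc u) zero    = trans (+-identityʳ _) (trans (*-identityʳ _) (cong _! (sym (+-identityʳ (suc u)))))
  binom-*-! (suc u) (suc v) = begin
    (binom u (suc v) + binom (suc u) v) * ((suc u * u !) * (suc v * v !))
      ≡⟨ pascal (binom u (suc v)) (binom (suc u) v) (suc u) (suc v) (u !) (v !) ⟩
    suc u * (binom u (suc v) * (u ! * (suc v * v !))) + suc v * (binom (suc u) v * ((suc u * u !) * v !))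
      ≡⟨ cong₂ (λ a b → suc u * a + suc v * b) (binom-*-! u (suc v)) (binom-*-! (suc u) v) ⟩
    suc u * (u + suc v) ! + suc v * (suc u + v) !
      ≡⟨ cong (λ w → suc u * w ! + suc v * (suc (u + v)) !) (+-suc u v) ⟩
    suc u * (suc (u + v)) ! + suc v * (suc (u + v)) !
      ≡⟨ *-distribʳ-+ ((suc (u + v)) !) (suc u) (suc v) ⟨
    (suc u + suc v) * (suc (u + v)) !
      ≡⟨ cong (λ w → (suc u + suc v) * w !) (+-suc u v) ⟨
    (suc u + suc v) ! ∎
    where
    open ≡-Reasoning
    pascal : ∀ p q a b f g → (p + q) * ((a * f) * (b * g)) ≡ a * (p * (f * (b * g))) + b * (q * ((a * f) * g))
    pascal = solve-∀

  kummer : ∀ u v → ∃ λ e → IsVal₂ (binom u v) e × e + B (u + v) ≡ B u + B v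
  kummer u v with legendre u | legendre v | legendre (u + v)
  ... | eu , vu , hu | ev , vv , hv | es , vs , hs
      with IsVal₂-cancelʳ (subst (λ m → IsVal₂ m es) (sym (binom-*-! u v)) vs) (IsVal₂-* vu vv)
  ... | e , ve , he = e , ve , +-cancelʳ-≡ (eu + ev) (e + B (u + v)) (B u + B v) (begin
    e + B (u + v) + (eu + ev)   ≡⟨ swap e (B (u + v)) (eu + ev) ⟩
    e + (eu + ev) + B (u + v)   ≡⟨ cong (_+ B (u + v)) he ⟩
    es + B (u + v)              ≡⟨ hs ⟩
    u + v                       ≡⟨ cong₂ _+_ hu hv ⟨
    eu + B u + (ev + B v)       ≡⟨ regroup eu (B u) ev (B v) ⟩
    B u + B v + (eu + ev)       ∎)
    where
    open ≡-Reasoning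
    swap : ∀ a b c → a + b + c ≡ a + c + b
    swap = solve-∀
    regroup : ∀ a b c d → a + b + (c + d) ≡ b + d + (a + c)
    regroup = solve-∀

  B-subadditive : ∀ u v → B (u + v) ≤ B u + B v
  B-subadditive u v with kummer u v
  ... | e , _ , h = subst (B (u + v) ≤_) h (m≤n+m (B (u + v)) e)

  B≤id : ∀ n → B n ≤ n
  B≤id n with legendre n
  ... | e , _ , h = subst (B n ≤_) h (m≤n+m (B n) e)

  2^B∣2^c*binom : ∀ u c → 2 ^ B (u + c) ∣ 2 ^ c * binom u (u + c)
  2^B∣2^c*binom u c with kummer u (u + c)
  ... | e , ve , h = ∣-trans (≤⇒2^∣2^ B[u+c]≤c+e) (IsVal₂⇒∣ (IsVal₂-* (IsVal₂-2^ c) ve))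
    where
    B[2u+c]≤Bu+c : B (u + (u + c)) ≤ B u + c
    B[2u+c]≤Bu+c = begin
      B (u + (u + c))   ≡⟨ cong B (+-assoc u u c) ⟨
      B (u + u + c)     ≤⟨ B-subadditive (u + u) c ⟩
      B (u + u) + B c   ≤⟨ +-mono-≤ (≤-reflexive (trans (cong B (cong (u +_) (sym (+-identityʳ u)))) (B-double u))) (B≤id c) ⟩
      B u + c           ∎
      where open ≤-Reasoning
    B[u+c]≤c+e : B (u + c) ≤ c + e
    B[u+c]≤c+e = +-cancelˡ-≤ (B u) _ _ (begin
      B u + B (u + c)     ≡⟨ h ⟨
      e + B (u + (u + c)) ≤⟨ +-monoʳ-≤ e B[2u+c]≤Bu+c ⟩
      e + (B u + c)       ≡⟨ rotate e (B u) c ⟩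
      B u + (c + e)       ∎)
      where
      open ≤-Reasoning
      rotate : ∀ a b c → a + (b + c) ≡ b + (c + a)
      rotate = solve-∀

  IsVal₂-2*binom[r,r] : ∀ r → IsVal₂ (2 * binom r r) (suc (B r))
  IsVal₂-2*binom[r,r] r = from-kummer (kummer r r)
    where
    B[r+r]≡Br : B (r + r) ≡ B r
    B[r+r]≡Br = trans (cong (λ x → B (r + x)) (sym (+-identityʳ r))) (B-double r)
    from-kummer : (∃ λ e → IsVal₂ (binom r r) e × e + B (r + r) ≡ B r + B r) → IsVal₂ (2 * binom r r) (suc (B r))
    from-kummer (e , v , h) =
      subst (IsVal₂ (2 * binom r r)) (cong suc (+-cancelʳ-≡ (B r) e (B r) (trans (cong (e +_) (sym B[r+r]≡Br)) h)))
            (IsVal₂-double v)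

  IsVal₂-2*binom[r,1+r] : ∀ r → IsVal₂ (2 * binom r (suc r)) (B (suc r))
  IsVal₂-2*binom[r,1+r] r = from-kummer (kummer r (suc r))
    where
    open ≡-Reasoning
    from-kummer : (∃ λ e → IsVal₂ (binom r (suc r)) e × e + B (r + suc r) ≡ B r + B (suc r)) →
                  IsVal₂ (2 * binom r (suc r)) (B (suc r))
    from-kummer (e , v , h) = subst (IsVal₂ (2 * binom r (suc r))) (+-cancelˡ-≡ (B r) (suc e) (B (suc r)) (begin
      B r + suc e       ≡⟨ +-suc (B r) e ⟩
      suc (B r + e)     ≡⟨ cong suc (+-comm (B r) e) ⟩
      suc (e + B r)     ≡⟨ +-suc e (B r) ⟨
      e + suc (B r)     ≡⟨ cong (e +_) (trans (sym (B-double+1 r)) (cong B (2r+1≡r+[1+r] r))) ⟩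
      e + B (r + suc r) ≡⟨ h ⟩
      B r + B (suc r)   ∎)) (IsVal₂-double v)

module Series where
  open import Data.Nat as ℕ using (ℕ; zero; suc; _<_; s≤s)
  import Data.Nat.Properties as ℕ
  import Data.Nat.Divisibility as ℕ
  open import Data.Integer hiding (_<_; _≤_; suc)
  open import Data.Integer.Properties
  open import Data.Integer.Divisibility.Signed using (_∣_; divides; ∣n⇒∣m*n; ∣m∣n⇒∣m+n; ∣ᵤ⇒∣)
  open import Data.Sum using (inj₁; inj₂)
  open import Data.Product using (_,_)
  open import Data.Integer.Tactic.RingSolver using (solve-∀)
  open import Relation.Binary.PropositionalEquality
  open ≡-Reasoning
  open TwoAdic using (binom; binom-zeroʳ)

  -- formal power series in t, given by their coefficient sequences
  Series : Set
  Series = ℕ → ℤ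

  1ₛ : Series
  1ₛ zero    = 1ℤ
  1ₛ (suc _) = 0ℤ

  t*_ : Series → Series
  (t* f) zero    = 0ℤ
  (t* f) (suc w) = f w

  [1+_t]*_ : ℤ → Series → Series
  ([1+ σ t]* f) w = f w + σ * (t* f) w

  [1+_t]^_ : ℤ → ℕ → Series
  [1+ σ t]^ zero  = 1ₛ
  [1+ σ t]^ suc N = [1+ σ t]* ([1+ σ t]^ N)

  [1+σt]*-constant : ∀ σ f → ([1+ σ t]* f) 0 ≡ f 0
  [1+σt]*-constant σ f = trans (cong (λ x → f 0 + x) (*-zeroʳ σ)) (+-identityʳ (f 0))

  [1+σt]^-constant : ∀ σ N → ([1+ σ t]^ N) 0 ≡ 1ℤ
  [1+σt]^-constant σ zero    = refl
  [1+σt]^-constant σ (suc N) = trans ([1+σt]*-constant σ ([1+ σ t]^ N)) ([1+σt]^-constant σ N)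

  [1+σt]^-vanish : ∀ σ {N u} → N < u → ([1+ σ t]^ N) u ≡ 0ℤ
  [1+σt]^-vanish σ {zero}  {suc u} _ = refl
  [1+σt]^-vanish σ {suc N} {suc u} (s≤s N<u) =
    trans (cong₂ (λ a b → a + σ * b) ([1+σt]^-vanish σ (ℕ.m<n⇒m<1+n N<u)) ([1+σt]^-vanish σ N<u))
          (trans (+-identityˡ (σ * 0ℤ)) (*-zeroʳ σ))

  [1+σt]^-coeff : ∀ σ u v → ([1+ σ t]^ (u ℕ.+ v)) u ≡ σ ^ u * + binom u v
  [1+σt]^-coeff σ zero    v       = [1+σt]^-constant σ v
  [1+σt]^-coeff σ (suc u) zero    = begin
    ([1+ σ t]^ (u ℕ.+ 0)) (suc u) + σ * ([1+ σ t]^ (u ℕ.+ 0)) u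
      ≡⟨ cong₂ (λ a b → a + σ * b) ([1+σt]^-vanish σ (s≤s (ℕ.≤-reflexive (ℕ.+-identityʳ u)))) ([1+σt]^-coeff σ u 0) ⟩
    0ℤ + σ * (σ ^ u * + binom u 0)
      ≡⟨ cong (λ b → 0ℤ + σ * (σ ^ u * + b)) (binom-zeroʳ u) ⟩
    0ℤ + σ * (σ ^ u * 1ℤ)
      ≡⟨ assoc σ (σ ^ u) ⟩
    σ ^ suc u * 1ℤ ∎
    where assoc : ∀ a b → 0ℤ + a * (b * 1ℤ) ≡ a * b * 1ℤ
          assoc = solve-∀
  [1+σt]^-coeff σ (suc u) (suc v) = begin
    ([1+ σ t]^ (u ℕ.+ suc v)) (suc u) + σ * ([1+ σ t]^ (u ℕ.+ suc v)) u
      ≡⟨ cong (λ N → ([1+ σ t]^ N) (suc u) + σ * ([1+ σ t]^ (u ℕ.+ suc v)) u) (ℕ.+-suc u v) ⟩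
    ([1+ σ t]^ (suc u ℕ.+ v)) (suc u) + σ * ([1+ σ t]^ (u ℕ.+ suc v)) u
      ≡⟨ cong₂ (λ a b → a + σ * b) ([1+σt]^-coeff σ (suc u) v) ([1+σt]^-coeff σ u (suc v)) ⟩
    σ * σ ^ u * + binom (suc u) v + σ * (σ ^ u * + binom u (suc v))
      ≡⟨ pascal σ (σ ^ u) (+ binom (suc u) v) (+ binom u (suc v)) ⟩
    σ * σ ^ u * (+ binom u (suc v) + + binom (suc u) v)
      ≡⟨ cong (σ * σ ^ u *_) (pos-+ (binom u (suc v)) (binom (suc u) v)) ⟨
    σ * σ ^ u * + binom (suc u) (suc v) ∎
    where pascal : ∀ a b x y → a * b * x + a * (b * y) ≡ a * b * (y + x)
          pascal = solve-∀

  [2t]^_*[1-t]^_ : ℕ → ℕ → Series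
  [2t]^ zero  *[1-t]^ M = [1+ -1ℤ t]^ M
  ([2t]^ suc a *[1-t]^ M) w = + 2 * (t* ([2t]^ a *[1-t]^ M)) w

  [2t]^*[1-t]^-vanish : ∀ {a} M {w} → w < a → ([2t]^ a *[1-t]^ M) w ≡ 0ℤ
  [2t]^*[1-t]^-vanish {suc a} M {zero}  _         = refl
  [2t]^*[1-t]^-vanish {suc a} M {suc w} (s≤s w<a) = cong (+ 2 *_) ([2t]^*[1-t]^-vanish M w<a)

  [2t]^*[1-t]^-shift : ∀ a M u → ([2t]^ a *[1-t]^ M) (a ℕ.+ u) ≡ + (2 ℕ.^ a) * ([1+ -1ℤ t]^ M) u
  [2t]^*[1-t]^-shift zero    M u = sym (*-identityˡ _)
  [2t]^*[1-t]^-shift (suc a) M u = begin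
    + 2 * ([2t]^ a *[1-t]^ M) (a ℕ.+ u)        ≡⟨ cong (+ 2 *_) ([2t]^*[1-t]^-shift a M u) ⟩
    + 2 * (+ (2 ℕ.^ a) * ([1+ -1ℤ t]^ M) u)   ≡⟨ *-assoc (+ 2) (+ (2 ℕ.^ a)) _ ⟨
    + 2 * + (2 ℕ.^ a) * ([1+ -1ℤ t]^ M) u     ≡⟨ cong (_* ([1+ -1ℤ t]^ M) u) (pos-* 2 (2 ℕ.^ a)) ⟨
    + (2 ℕ.^ suc a) * ([1+ -1ℤ t]^ M) u       ∎

  -- the ℤ-span of the series (2t)^a (1-t)^M with a + M = N; ≗-span replaces function extensionality
  data Span (N : ℕ) : Series → Set where
    gen  : ∀ z a M → a ℕ.+ M ≡ N → Span N (λ w → z * ([2t]^ a *[1-t]^ M) w)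
    _⊕_  : ∀ {f g} → Span N f → Span N g → Span N (λ w → f w + g w)
    ≗-span : ∀ {f g} → (∀ w → f w ≡ g w) → Span N g → Span N f

  t*-scale : ∀ z f w → (t* (λ v → z * f v)) w ≡ z * (t* f) w
  t*-scale z f zero    = sym (*-zeroʳ z)
  t*-scale z f (suc w) = refl

  t*-+ : ∀ f g w → (t* (λ v → f v + g v)) w ≡ (t* f) w + (t* g) w
  t*-+ f g zero    = refl
  t*-+ f g (suc w) = refl

  t*-≗ : ∀ {f g} → (∀ w → f w ≡ g w) → ∀ w → (t* f) w ≡ (t* g) w
  t*-≗ f≗g zero    = refl
  t*-≗ f≗g (suc w) = f≗g w

  [1-t]*-[2t]^*[1-t]^ : ∀ a M w → ([1+ -1ℤ t]* ([2t]^ a *[1-t]^ M)) w ≡ ([2t]^ a *[1-t]^ suc M) w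
  [1-t]*-[2t]^*[1-t]^ zero    M w       = refl
  [1-t]*-[2t]^*[1-t]^ (suc a) M zero    = refl
  [1-t]*-[2t]^*[1-t]^ (suc a) M (suc w) =
    trans (factor (([2t]^ a *[1-t]^ M) w) ((t* ([2t]^ a *[1-t]^ M)) w))
          (cong (+ 2 *_) ([1-t]*-[2t]^*[1-t]^ a M w))
    where factor : ∀ x y → + 2 * x + -1ℤ * (+ 2 * y) ≡ + 2 * (x + -1ℤ * y)
          factor = solve-∀

  Span-[1-t]* : ∀ {N f} → Span N f → Span (suc N) ([1+ -1ℤ t]* f)
  Span-[1-t]* (gen z a M refl) = ≗-span eq (gen z a (suc M) (ℕ.+-suc a M))
    where
    eq : ∀ w → ([1+ -1ℤ t]* (λ v → z * ([2t]^ a *[1-t]^ M) v)) w ≡ z * ([2t]^ a *[1-t]^ suc M) w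
    eq w = begin
      z * g w + -1ℤ * (t* (λ v → z * g v)) w ≡⟨ cong (λ x → z * g w + -1ℤ * x) (t*-scale z g w) ⟩
      z * g w + -1ℤ * (z * (t* g) w)         ≡⟨ factor z (g w) ((t* g) w) ⟩
      z * ([1+ -1ℤ t]* g) w                  ≡⟨ cong (z *_) ([1-t]*-[2t]^*[1-t]^ a M w) ⟩
      z * ([2t]^ a *[1-t]^ suc M) w          ∎
      where
      g = [2t]^ a *[1-t]^ M
      factor : ∀ z x y → z * x + -1ℤ * (z * y) ≡ z * (x + -1ℤ * y)
      factor = solve-∀
  Span-[1-t]* (_⊕_ {f} {g} sf sg) = ≗-span eq (Span-[1-t]* sf ⊕ Span-[1-t]* sg)
    where
    eq : ∀ w → ([1+ -1ℤ t]* (λ v → f v + g v)) w ≡ ([1+ -1ℤ t]* f) w + ([1+ -1ℤ t]* g) w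
    eq w = trans (cong (λ x → f w + g w + -1ℤ * x) (t*-+ f g w)) (regroup (f w) (g w) ((t* f) w) ((t* g) w))
      where regroup : ∀ a b c d → a + b + -1ℤ * (c + d) ≡ a + -1ℤ * c + (b + -1ℤ * d)
            regroup = solve-∀
  Span-[1-t]* (≗-span f≗g sg) = ≗-span (λ w → cong₂ (λ a b → a + -1ℤ * b) (f≗g w) (t*-≗ f≗g w)) (Span-[1-t]* sg)

  Span-[2t]* : ∀ {N f} → Span N f → Span (suc N) (λ w → + 2 * (t* f) w)
  Span-[2t]* (gen z a M refl) = ≗-span (λ w → trans (cong (+ 2 *_) (t*-scale z ([2t]^ a *[1-t]^ M) w)) (swap z _))
                                       (gen z (suc a) M refl)
    where swap : ∀ z x → + 2 * (z * x) ≡ z * (+ 2 * x)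
          swap = solve-∀
  Span-[2t]* (_⊕_ {f} {g} sf sg) = ≗-span (λ w → trans (cong (+ 2 *_) (t*-+ f g w)) (*-distribˡ-+ (+ 2) ((t* f) w) ((t* g) w)))
                                          (Span-[2t]* sf ⊕ Span-[2t]* sg)
  Span-[2t]* (≗-span f≗g sg) = ≗-span (λ w → cong (+ 2 *_) (t*-≗ f≗g w)) (Span-[2t]* sg)

  -- 1 + t = (1 - t) + 2t
  Span-[1+t]* : ∀ {N f} → Span N f → Span (suc N) ([1+ 1ℤ t]* f)
  Span-[1+t]* {f = f} sf = ≗-span (λ w → split (f w) ((t* f) w)) (Span-[1-t]* sf ⊕ Span-[2t]* sf)
    where split : ∀ x y → x + 1ℤ * y ≡ x + -1ℤ * y + + 2 * y
          split = solve-∀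

  Span-∣ : ∀ {N f} d c r → (∀ a M → a ℕ.+ M ≡ N → d ∣ c * ([2t]^ a *[1-t]^ M) r) → Span N f → d ∣ c * f r
  Span-∣ d c r d∣gen (gen z a M eq) =
    subst (d ∣_) (swap z c _) (∣n⇒∣m*n z (d∣gen a M eq))
    where swap : ∀ z c x → z * (c * x) ≡ c * (z * x)
          swap = solve-∀
  Span-∣ d c r d∣gen (_⊕_ {f} {g} sf sg) =
    subst (d ∣_) (sym (*-distribˡ-+ c (f r) (g r))) (∣m∣n⇒∣m+n (Span-∣ d c r d∣gen sf) (Span-∣ d c r d∣gen sg))
  Span-∣ d c r d∣gen (≗-span f≗g sg) = subst (λ x → d ∣ c * x) (sym (f≗g r)) (Span-∣ d c r d∣gen sg)

  -- the coefficient of t^r in (2t)^a (1-t)^(u+v) is ± 2^a C(u+v, u), where a + u = r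
  Span-binom-∣ : ∀ {N f} d c r → (∀ a u v → a ℕ.+ (u ℕ.+ v) ≡ N → a ℕ.+ u ≡ r → d ℕ.∣ c ℕ.* 2 ℕ.^ a ℕ.* binom u v) →
                 Span N f → + d ∣ + c * f r
  Span-binom-∣ {N} d c r hyp = Span-∣ (+ d) (+ c) r d∣gen
    where
    d∣0 : ∀ {x} → x ≡ 0ℤ → + d ∣ + c * x
    d∣0 refl = subst (+ d ∣_) (sym (*-zeroʳ (+ c))) (divides 0ℤ refl)
    d∣gen : ∀ a M → a ℕ.+ M ≡ N → + d ∣ + c * ([2t]^ a *[1-t]^ M) r
    d∣gen a M a+M≡N with ℕ.≤-<-connex a r
    ... | inj₂ r<a = d∣0 ([2t]^*[1-t]^-vanish M r<a)
    ... | inj₁ a≤r with ℕ.m≤n⇒∃[o]m+o≡n a≤r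
    ... | u , refl with ℕ.≤-<-connex u M
    ... | inj₂ M<u = d∣0 (trans ([2t]^*[1-t]^-shift a M u) (trans (cong (+ (2 ℕ.^ a) *_) ([1+σt]^-vanish -1ℤ M<u)) (*-zeroʳ (+ (2 ℕ.^ a)))))
    ... | inj₁ u≤M with ℕ.m≤n⇒∃[o]m+o≡n u≤M
    ... | v , refl = subst (+ d ∣_) (sym coeff) (∣n⇒∣m*n (-1ℤ ^ u) (∣ᵤ⇒∣ (hyp a u v a+M≡N refl)))
      where
      coeff : + c * ([2t]^ a *[1-t]^ (u ℕ.+ v)) (a ℕ.+ u) ≡ -1ℤ ^ u * + (c ℕ.* 2 ℕ.^ a ℕ.* binom u v)
      coeff = begin
        + c * ([2t]^ a *[1-t]^ (u ℕ.+ v)) (a ℕ.+ u)         ≡⟨ cong (+ c *_) ([2t]^*[1-t]^-shift a (u ℕ.+ v) u) ⟩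
        + c * (+ (2 ℕ.^ a) * ([1+ -1ℤ t]^ (u ℕ.+ v)) u)    ≡⟨ cong (λ x → + c * (+ (2 ℕ.^ a) * x)) ([1+σt]^-coeff -1ℤ u v) ⟩
        + c * (+ (2 ℕ.^ a) * (-1ℤ ^ u * + binom u v))      ≡⟨ regroup (+ c) (+ (2 ℕ.^ a)) (-1ℤ ^ u) (+ binom u v) ⟩
        -1ℤ ^ u * (+ c * + (2 ℕ.^ a) * + binom u v)        ≡⟨ cong (λ x → -1ℤ ^ u * (x * + binom u v)) (pos-* c (2 ℕ.^ a)) ⟨
        -1ℤ ^ u * (+ (c ℕ.* 2 ℕ.^ a) * + binom u v)        ≡⟨ cong (-1ℤ ^ u *_) (pos-* (c ℕ.* 2 ℕ.^ a) (binom u v)) ⟨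
        -1ℤ ^ u * + (c ℕ.* 2 ℕ.^ a ℕ.* binom u v)          ∎
        where regroup : ∀ c p s b → c * (p * (s * b)) ≡ s * (c * p * b)
              regroup = solve-∀

module BooleanCube where
  open import Data.Bool using (Bool; true; false; not; if_then_else_)
  open import Data.Nat as ℕ using (ℕ; zero; suc; _≤_; _<_; _≤?_; _≡ᵇ_)
  import Data.Nat.Properties as ℕ
  open import Data.Integer hiding (_≤_; _<_; _≤?_; suc)
  open import Data.Integer.Properties hiding (≤-refl; _≤?_)
  open import Data.Integer.Tactic.RingSolver using (solve-∀)
  open import Data.List using ([]; _∷_; map; _++_)
  open import Data.List.Properties using (map-++; map-∘; map-cong)
  open import Data.Vec using (Vec; []; _∷_; replicate; removeAt)
  open import Data.Vec.Relation.Unary.Any using (Any; here; there; index)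
  open import Data.Sum using (_⊎_; inj₁; inj₂)
  open import Relation.Nullary using (yes; no)
  open import Relation.Binary.PropositionalEquality
  open ≡-Reasoning
  open Series
  open TwoAdic using (2r+1≡r+[1+r])

  sumℤ-++ : ∀ xs ys → sumℤ (xs ++ ys) ≡ sumℤ xs + sumℤ ys
  sumℤ-++ []       ys = sym (+-identityˡ (sumℤ ys))
  sumℤ-++ (x ∷ xs) ys = trans (cong (_+_ x) (sumℤ-++ xs ys)) (sym (+-assoc x (sumℤ xs) (sumℤ ys)))

  module _ {A : Set} where

    sumℤ-map-+ : ∀ (F G : A → ℤ) xs → sumℤ (map (λ x → F x + G x) xs) ≡ sumℤ (map F xs) + sumℤ (map G xs)
    sumℤ-map-+ F G []       = refl
    sumℤ-map-+ F G (x ∷ xs) = trans (cong (_+_ (F x + G x)) (sumℤ-map-+ F G xs)) (regroup (F x) (G x) _ _)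
      where regroup : ∀ a b c d → a + b + (c + d) ≡ a + c + (b + d)
            regroup = solve-∀

    sumℤ-map-* : ∀ z (F : A → ℤ) xs → sumℤ (map (λ x → z * F x) xs) ≡ z * sumℤ (map F xs)
    sumℤ-map-* z F []       = sym (*-zeroʳ z)
    sumℤ-map-* z F (x ∷ xs) = trans (cong (_+_ (z * F x)) (sumℤ-map-* z F xs)) (sym (*-distribˡ-+ z (F x) _))

  Σ-cube : (n : ℕ) → (Vec Bool n → ℤ) → ℤ
  Σ-cube n F = sumℤ (map F (allVecs n))

  Σ-cube-suc : ∀ n F → Σ-cube (suc n) F ≡ Σ-cube n (λ x → F (false ∷ x)) + Σ-cube n (λ x → F (true ∷ x))
  Σ-cube-suc n F = begin
    sumℤ (map F (map (false ∷_) xs ++ map (true ∷_) xs))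
      ≡⟨ cong sumℤ (map-++ F (map (false ∷_) xs) (map (true ∷_) xs)) ⟩
    sumℤ (map F (map (false ∷_) xs) ++ map F (map (true ∷_) xs))
      ≡⟨ sumℤ-++ (map F (map (false ∷_) xs)) _ ⟩
    sumℤ (map F (map (false ∷_) xs)) + sumℤ (map F (map (true ∷_) xs))
      ≡⟨ cong₂ (λ a b → sumℤ a + sumℤ b) (map-∘ xs) (map-∘ xs) ⟨
    Σ-cube n (λ x → F (false ∷ x)) + Σ-cube n (λ x → F (true ∷ x)) ∎
    where xs = allVecs n

  Σ-cube-cong : ∀ n {F G} → (∀ x → F x ≡ G x) → Σ-cube n F ≡ Σ-cube n G
  Σ-cube-cong n F≗G = cong sumℤ (map-cong F≗G (allVecs n))

  Σ-cube-+ : ∀ n F G → Σ-cube n (λ x → F x + G x) ≡ Σ-cube n F + Σ-cube n G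
  Σ-cube-+ n F G = sumℤ-map-+ F G (allVecs n)

  Σ-cube-* : ∀ n z F → Σ-cube n (λ x → z * F x) ≡ z * Σ-cube n F
  Σ-cube-* n z F = sumℤ-map-* z F (allVecs n)

  complement : ∀ {n} → Vec Bool n → Vec Bool n
  complement []      = []
  complement (b ∷ x) = not b ∷ complement x

  Σ-cube-complement : ∀ n F → Σ-cube n (λ x → F (complement x)) ≡ Σ-cube n F
  Σ-cube-complement zero    F = refl
  Σ-cube-complement (suc n) F = begin
    Σ-cube (suc n) (λ x → F (complement x))
      ≡⟨ Σ-cube-suc n (λ x → F (complement x)) ⟩
    Σ-cube n (λ x → F (true ∷ complement x)) + Σ-cube n (λ x → F (false ∷ complement x))
      ≡⟨ cong₂ _+_ (Σ-cube-complement n (λ x → F (true ∷ x))) (Σ-cube-complement n (λ x → F (false ∷ x))) ⟩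
    Σ-cube n (λ x → F (true ∷ x)) + Σ-cube n (λ x → F (false ∷ x))
      ≡⟨ +-comm (Σ-cube n (λ x → F (true ∷ x))) (Σ-cube n (λ x → F (false ∷ x))) ⟩
    Σ-cube n (λ x → F (false ∷ x)) + Σ-cube n (λ x → F (true ∷ x))
      ≡⟨ Σ-cube-suc n F ⟨
    Σ-cube (suc n) F ∎

  signOf : Bool → ℤ
  signOf false = 1ℤ
  signOf true  = -1ℤ

  χ-cons-false : ∀ {n} s (S x : Vec Bool n) → χ (s ∷ S) (false ∷ x) ≡ χ S x
  χ-cons-false false S x = *-identityˡ (χ S x)
  χ-cons-false true  S x = *-identityˡ (χ S x)

  χ-cons-true : ∀ {n} s (S x : Vec Bool n) → χ (s ∷ S) (true ∷ x) ≡ signOf s * χ S x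
  χ-cons-true false S x = refl
  χ-cons-true true  S x = refl

  χ-zeros : ∀ {n} (x : Vec Bool n) → χ (replicate n false) x ≡ 1ℤ
  χ-zeros []      = refl
  χ-zeros (b ∷ x) = trans (*-identityˡ _) (χ-zeros x)

  indicator : ℕ → ℕ → ℤ
  indicator w v = if w ≡ᵇ v then 1ℤ else 0ℤ

  -- generating series of the Krawtchouk values of S; it equals (1 + t)^(n - |S|) (1 - t)^|S|
  K : ∀ {n} → Vec Bool n → Series
  K {n} S w = Σ-cube n (λ x → indicator w (weight x) * χ S x)

  K-nil : ∀ w → K [] w ≡ 1ₛ w
  K-nil zero    = refl
  K-nil (suc w) = refl

  K-cons : ∀ {n} s (S : Vec Bool n) w → K (s ∷ S) w ≡ ([1+ signOf s t]* K S) w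
  K-cons {n} s S w = begin
    K (s ∷ S) w
      ≡⟨ Σ-cube-suc n _ ⟩
    Σ-cube n (λ x → indicator w (weight x) * χ (s ∷ S) (false ∷ x))
      + Σ-cube n (λ x → indicator w (suc (weight x)) * χ (s ∷ S) (true ∷ x))
      ≡⟨ cong₂ _+_ (Σ-cube-cong n (λ x → cong (indicator w (weight x) *_) (χ-cons-false s S x)))
                   (trans (Σ-cube-cong n (λ x → cong (indicator w (suc (weight x)) *_) (χ-cons-true s S x)))
                          (shifted w)) ⟩
    K S w + signOf s * (t* K S) w ∎
    where
    swap : ∀ a σ c → a * (σ * c) ≡ σ * (a * c)
    swap = solve-∀
    shifted : ∀ w → Σ-cube n (λ x → indicator w (suc (weight x)) * (signOf s * χ S x)) ≡ signOf s * (t* K S) w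
    shifted zero    = trans (Σ-cube-cong n (λ x → *-zeroˡ (signOf s * χ S x)))
                            (trans (Σ-cube-* n 0ℤ (λ _ → 0ℤ)) (sym (*-zeroʳ (signOf s))))
    shifted (suc w) = trans (Σ-cube-cong n (λ x → swap (indicator w (weight x)) (signOf s) (χ S x)))
                            (Σ-cube-* n (signOf s) _)

  K-Span : ∀ {N} (S : Vec Bool N) → Span N (K S)
  K-Span []          = ≗-span K-nil (≗-span (λ w → sym (*-identityˡ (1ₛ w))) (gen 1ℤ 0 0 refl))
  K-Span (false ∷ S) = ≗-span (K-cons false S) (Span-[1+t]* (K-Span S))
  K-Span (true ∷ S)  = ≗-span (K-cons true S) (Span-[1-t]* (K-Span S))

  K-zeros : ∀ N w → K (replicate N false) w ≡ ([1+ 1ℤ t]^ N) w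
  K-zeros zero    w = K-nil w
  K-zeros (suc N) w = trans (K-cons false (replicate N false) w)
                            (cong₂ (λ a b → a + 1ℤ * b) (K-zeros N w) (t*-≗ (K-zeros N) w))

  threshold : ℕ → ℕ → ℤ
  threshold zero    _       = -1ℤ
  threshold (suc h) zero    = 1ℤ
  threshold (suc h) (suc w) = threshold h w

  threshold-≤ : ∀ {h w} → h ≤ w → threshold h w ≡ -1ℤ
  threshold-≤ {zero}  _              = refl
  threshold-≤ {suc h} (ℕ.s≤s h≤w) = threshold-≤ h≤w

  threshold-> : ∀ {h w} → w < h → threshold h w ≡ 1ℤ
  threshold-> {suc h} {zero}  _              = refl
  threshold-> {suc h} {suc w} (ℕ.s≤s w<h) = threshold-> w<h

  threshold-step : ∀ h w → threshold (suc h) w ≡ threshold h w + + 2 * indicator h w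
  threshold-step zero    zero    = refl
  threshold-step zero    (suc w) = refl
  threshold-step (suc h) zero    = refl
  threshold-step (suc h) (suc w) = threshold-step h w

  threshold-shift : ∀ h w → threshold h (suc w) ≡ threshold (ℕ.pred h) w
  threshold-shift zero    w = refl
  threshold-shift (suc h) w = refl

  T : ∀ {n} → Vec Bool n → ℕ → ℤ
  T {n} S h = Σ-cube n (λ x → threshold h (weight x) * χ S x)

  T-cons : ∀ {n} s (S : Vec Bool n) h → T (s ∷ S) h ≡ T S h + signOf s * T S (ℕ.pred h)
  T-cons {n} s S h = begin
    T (s ∷ S) h
      ≡⟨ Σ-cube-suc n _ ⟩
    Σ-cube n (λ x → threshold h (weight x) * χ (s ∷ S) (false ∷ x))
      + Σ-cube n (λ x → threshold h (suc (weight x)) * χ (s ∷ S) (true ∷ x))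
      ≡⟨ cong₂ _+_ (Σ-cube-cong n (λ x → cong (threshold h (weight x) *_) (χ-cons-false s S x)))
                   (trans (Σ-cube-cong n shift) (Σ-cube-* n (signOf s) _)) ⟩
    T S h + signOf s * T S (ℕ.pred h) ∎
    where
    swap : ∀ a σ c → a * (σ * c) ≡ σ * (a * c)
    swap = solve-∀
    shift : ∀ x → threshold h (suc (weight x)) * χ (s ∷ S) (true ∷ x)
                ≡ signOf s * (threshold (ℕ.pred h) (weight x) * χ S x)
    shift x = trans (cong₂ _*_ (threshold-shift h (weight x)) (χ-cons-true s S x))
                    (swap (threshold (ℕ.pred h) (weight x)) (signOf s) (χ S x))

  T-step : ∀ {n} (S : Vec Bool n) h → T S (suc h) ≡ T S h + + 2 * K S h
  T-step {n} S h = begin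
    T S (suc h)
      ≡⟨ Σ-cube-cong n (λ x → trans (cong (_* χ S x) (threshold-step h (weight x)))
                                    (distrib (threshold h (weight x)) (indicator h (weight x)) (χ S x))) ⟩
    Σ-cube n (λ x → threshold h (weight x) * χ S x + + 2 * (indicator h (weight x) * χ S x))
      ≡⟨ Σ-cube-+ n _ _ ⟩
    T S h + Σ-cube n (λ x → + 2 * (indicator h (weight x) * χ S x))
      ≡⟨ cong (_+_ (T S h)) (Σ-cube-* n (+ 2) _) ⟩
    T S h + + 2 * K S h ∎
    where distrib : ∀ a b c → (a + + 2 * b) * c ≡ a * c + + 2 * (b * c)
          distrib = solve-∀

  -- Pairing each x with the x that differs in a coordinate i ∈ S: only the inputs of
  -- weight h - 1 outside i contribute, each twice.
  T-member : ∀ {n} (S : Vec Bool (suc n)) (i : Any (_≡ true) S) h → T S h ≡ + 2 * (t* K (removeAt S (index i))) h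
  T-member (true ∷ S) (here refl) zero    = trans (T-cons true S 0) (x-x≡0 (T S 0))
    where x-x≡0 : ∀ x → x + -1ℤ * x ≡ 0ℤ
          x-x≡0 = solve-∀
  T-member (true ∷ S) (here refl) (suc h) =
    trans (T-cons true S (suc h)) (trans (cong (λ x → x + -1ℤ * T S h) (T-step S h)) (cancel (T S h) (K S h)))
    where cancel : ∀ x k → x + + 2 * k + -1ℤ * x ≡ + 2 * k
          cancel = solve-∀
  T-member (s ∷ S@(_ ∷ _)) (there i) zero    =
    trans (T-cons s S 0) (trans (cong₂ (λ a b → a + signOf s * b) (T-member S i 0) (T-member S i 0))
                                (cong (_+_ 0ℤ) (*-zeroʳ (signOf s))))
  T-member (s ∷ S@(_ ∷ _)) (there i) (suc h) = begin
    T (s ∷ S) (suc h)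
      ≡⟨ T-cons s S (suc h) ⟩
    T S (suc h) + signOf s * T S h
      ≡⟨ cong₂ (λ a b → a + signOf s * b) (T-member S i (suc h)) (T-member S i h) ⟩
    + 2 * K R h + signOf s * (+ 2 * (t* K R) h)
      ≡⟨ factor (signOf s) (K R h) ((t* K R) h) ⟩
    + 2 * ([1+ signOf s t]* K R) h
      ≡⟨ cong (+ 2 *_) (K-cons s R h) ⟨
    + 2 * K (s ∷ R) h ∎
    where
    R = removeAt S (index i)
    factor : ∀ σ k k' → + 2 * k + σ * (+ 2 * k') ≡ + 2 * (k + σ * k')
    factor = solve-∀

  empty-or-member : ∀ {n} (S : Vec Bool n) → S ≡ replicate n false ⊎ Any (_≡ true) S
  empty-or-member []          = inj₁ refl
  empty-or-member (true ∷ S)  = inj₂ (here refl)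
  empty-or-member (false ∷ S) with empty-or-member S
  ... | inj₁ refl = inj₁ refl
  ... | inj₂ i    = inj₂ (there i)

  weight-complement : ∀ {n} (x : Vec Bool n) → weight x ℕ.+ weight (complement x) ≡ n
  weight-complement []          = refl
  weight-complement (false ∷ x) = trans (ℕ.+-suc (weight x) _) (cong suc (weight-complement x))
  weight-complement (true ∷ x)  = cong suc (weight-complement x)

  threshold-antisym : ∀ r {w v} → w ℕ.+ v ≡ suc (2 ℕ.* r) → threshold (suc r) v ≡ - threshold (suc r) w
  threshold-antisym r {w} {v} w+v≡2r+1 with suc r ≤? v
  ... | yes r<v = trans (threshold-≤ r<v) (cong -_ (sym (threshold-> (ℕ.s≤s w≤r))))
    where
    w≤r : w ≤ r
    w≤r = ℕ.+-cancelʳ-≤ (suc r) w r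
            (ℕ.≤-trans (ℕ.+-monoʳ-≤ w r<v) (ℕ.≤-reflexive (trans w+v≡2r+1 (2r+1≡r+[1+r] r))))
  ... | no r≮v = trans (threshold-> (ℕ.≰⇒> r≮v)) (cong -_ (sym (threshold-≤ r<w)))
    where
    r<w : suc r ≤ w
    r<w = ℕ.+-cancelʳ-≤ r (suc r) w (ℕ.≤-trans (ℕ.≤-reflexive (trans (ℕ.+-comm (suc r) r) (sym (trans w+v≡2r+1 (2r+1≡r+[1+r] r)))))
                                               (ℕ.+-monoʳ-≤ w (ℕ.≤-pred (ℕ.≰⇒> r≮v))))

  self-negating⇒0 : ∀ {x} → x ≡ - x → x ≡ 0ℤ
  self-negating⇒0 {+0} _ = refl

  T-zeros-odd : ∀ r → T (replicate (suc (2 ℕ.* r)) false) (suc r) ≡ 0ℤ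
  T-zeros-odd r = self-negating⇒0 (begin
    Σ-cube n F                  ≡⟨ Σ-cube-complement n F ⟨
    Σ-cube n (λ x → F (complement x)) ≡⟨ Σ-cube-cong n F∘complement ⟩
    Σ-cube n (λ x → -1ℤ * F x) ≡⟨ Σ-cube-* n -1ℤ F ⟩
    -1ℤ * Σ-cube n F ≡⟨ -1*i≡-i _ ⟩
    - Σ-cube n F ∎)
    where
    n = suc (2 ℕ.* r)
    F : Vec Bool n → ℤ
    F x = threshold (suc r) (weight x) * χ (replicate n false) x
    negate : ∀ a c → - a * c ≡ -1ℤ * (a * c)
    negate = solve-∀
    F∘complement : ∀ x → F (complement x) ≡ -1ℤ * F x
    F∘complement x = trans (cong₂ _*_ (threshold-antisym r {weight x} {weight (complement x)} (weight-complement x)) (trans (χ-zeros (complement x)) (sym (χ-zeros x))))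
                           (negate (threshold (suc r) (weight x)) (χ (replicate n false) x))

module Majority where
  open import Data.Bool using (Bool; true; false)
  open import Data.Nat as ℕ using (ℕ; zero; suc; _+_; _*_; _^_; _≤_; _≤?_)
  import Data.Nat.Properties as ℕ
  open import Data.Nat.Divisibility as ℕ using (*-monoʳ-∣; ∣-trans; ∣-reflexive)
  open import Data.Nat.Tactic.RingSolver using (solve-∀)
  import Data.Integer.Tactic.RingSolver as ℤ-Solver
  open import Data.Integer as ℤ using (ℤ; +_; 0ℤ; 1ℤ; -1ℤ; -_; ∣_∣)
  import Data.Integer.Properties as ℤ
  open import Data.Integer.Divisibility.Signed as ℤ using (divides; ∣m⇒∣-m; ∣ᵤ⇒∣)
  open import Data.Vec using (Vec; _∷_; replicate; removeAt)
  open import Data.Vec.Relation.Unary.Any using (here; index)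
  open import Data.Sum using (inj₁; inj₂)
  open import Function.Bundles using (_⇔_; Equivalence; mk⇔)
  open import Relation.Nullary using (yes; no)
  open import Relation.Binary.PropositionalEquality
  open ≡-Reasoning
  open TwoAdic
  open Series
  open BooleanCube

  MAJ≡threshold : ∀ {n h} → (∀ w → n ≤ 2 * w ⇔ h ≤ w) → ∀ x → MAJ n x ≡ threshold h (weight x)
  MAJ≡threshold {n} n≤2w⇔h≤w x with n ≤? 2 * weight x
  ... | yes n≤2w = sym (threshold-≤ (Equivalence.to (n≤2w⇔h≤w _) n≤2w))
  ... | no  n≰2w = sym (threshold-> (ℕ.≰⇒> (λ h≤w → n≰2w (Equivalence.from (n≤2w⇔h≤w _) h≤w))))

  majority-threshold-odd : ∀ r w → suc (2 * r) ≤ 2 * w ⇔ suc r ≤ w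
  majority-threshold-odd r w = mk⇔ (ℕ.*-cancelˡ-< 2 r w) (ℕ.*-monoʳ-< 2)

  majority-threshold-even : ∀ r w → 2 + 2 * r ≤ 2 * w ⇔ suc r ≤ w
  majority-threshold-even r w = subst (λ n → n ≤ 2 * w ⇔ suc r ≤ w) (ℕ.*-suc 2 r) (mk⇔ (ℕ.*-cancelˡ-≤ 2) (ℕ.*-monoʳ-≤ 2))

  A : (n : ℕ) → Vec Bool n → ℤ
  A n S = Σ-cube n (λ x → MAJ n x ℤ.* χ S x)

  A≡T : ∀ {n h} → (∀ w → n ≤ 2 * w ⇔ h ≤ w) → ∀ S → A n S ≡ T S h
  A≡T n≤2w⇔h≤w S = Σ-cube-cong _ (λ x → cong (ℤ._* χ S x) (MAJ≡threshold n≤2w⇔h≤w x))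

  data Parity : ℕ → Set where
    even : ∀ r → Parity (2 * r)
    odd  : ∀ r → Parity (suc (2 * r))

  parity : ∀ n → Parity n
  parity zero = even 0
  parity (suc n) with parity n
  ... | even r = odd r
  ... | odd r  = subst Parity (ℕ.*-suc 2 r) (even (suc r))

  K-zeros-coeff : ∀ u v → K (replicate (u + v) false) u ≡ + binom u v
  K-zeros-coeff u v = trans (K-zeros (u + v) u)
                            (trans ([1+σt]^-coeff 1ℤ u v) (trans (cong (ℤ._* + binom u v) (ℤ.^-zeroˡ u)) (ℤ.*-identityˡ _)))

  ∣0ℤ : ∀ {d} → d ℤ.∣ 0ℤ
  ∣0ℤ = divides 0ℤ refl

  2^B∣A-odd : ∀ r S → + (2 ^ B (suc (2 * r))) ℤ.∣ A (suc (2 * r)) S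
  2^B∣A-odd r S = subst₂ (λ k → + (2 ^ k) ℤ.∣_) (sym (B-double+1 r)) (sym (A≡T (majority-threshold-odd r) S)) 2^B∣T
    where
    d = 2 ^ suc (B r)
    double : ∀ a u → 2 * (a + u) ≡ a + u + (u + a)
    double = solve-∀
    2^B∣gen : ∀ a u v → a + (u + v) ≡ 2 * r → a + u ≡ r → d ℕ.∣ 2 * 2 ^ a * binom u v
    2^B∣gen a u v a+u+v≡2r refl with ℕ.+-cancelˡ-≡ (a + u) v (u + a) (trans (ℕ.+-assoc a u v) (trans a+u+v≡2r (double a u)))
    ... | refl = ∣-trans (*-monoʳ-∣ 2 (subst (λ m → 2 ^ B m ℕ.∣ 2 ^ a * binom u (u + a)) (ℕ.+-comm u a) (2^B∣2^c*binom u a)))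
                         (∣-reflexive (sym (ℕ.*-assoc 2 (2 ^ a) (binom u (u + a)))))
    2^B∣T : + d ℤ.∣ T S (suc r)
    2^B∣T with empty-or-member S
    ... | inj₁ refl = subst (+ d ℤ.∣_) (sym (T-zeros-odd r)) ∣0ℤ
    ... | inj₂ i    = subst (+ d ℤ.∣_) (sym (T-member S i (suc r))) (Span-binom-∣ d 2 r 2^B∣gen (K-Span (removeAt S (index i))))

  T-zeros-even : ∀ r → T (replicate (2 + 2 * r) false) (suc r) ≡ - (+ 2 ℤ.* + binom r (suc r))
  T-zeros-even r = begin
    T (false ∷ Z) (suc r)         ≡⟨ T-cons false Z (suc r) ⟩
    T Z (suc r) ℤ.+ 1ℤ ℤ.* T Z r  ≡⟨ cong (λ x → x ℤ.+ 1ℤ ℤ.* T Z r) (T-zeros-odd r) ⟩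
    0ℤ ℤ.+ 1ℤ ℤ.* T Z r           ≡⟨ solve-for-T (T Z r) (K Z r) (trans (sym (T-step Z r)) (T-zeros-odd r)) ⟩
    - (+ 2 ℤ.* K Z r)             ≡⟨ cong (λ x → - (+ 2 ℤ.* x)) Kr ⟩
    - (+ 2 ℤ.* + binom r (suc r)) ∎
    where
    Z = replicate (suc (2 * r)) false
    Kr : K Z r ≡ + binom r (suc r)
    Kr = trans (cong (λ n → K (replicate n false) r) (2r+1≡r+[1+r] r)) (K-zeros-coeff r (suc r))
    solve-for-T : ∀ x k → x ℤ.+ + 2 ℤ.* k ≡ 0ℤ → 0ℤ ℤ.+ 1ℤ ℤ.* x ≡ - (+ 2 ℤ.* k)
    solve-for-T x k eq = trans (isolate x (+ 2 ℤ.* k)) (trans (cong (ℤ._- + 2 ℤ.* k) eq) (ℤ.+-identityˡ _))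
      where isolate : ∀ x y → 0ℤ ℤ.+ 1ℤ ℤ.* x ≡ x ℤ.+ y ℤ.- y
            isolate = ℤ-Solver.solve-∀

  2^B∣A-even : ∀ r S → + (2 ^ B (2 + 2 * r)) ℤ.∣ A (2 + 2 * r) S
  2^B∣A-even r S = subst₂ (λ k → + (2 ^ k) ℤ.∣_) (sym (B-2+2* r)) (sym (A≡T (majority-threshold-even r) S)) 2^B∣T
    where
    d = 2 ^ B (suc r)
    split : ∀ a u → suc (2 * (a + u)) ≡ a + u + (u + suc a)
    split = solve-∀
    2^B∣gen : ∀ a u v → a + (u + v) ≡ suc (2 * r) → a + u ≡ r → d ℕ.∣ 2 * 2 ^ a * binom u v
    2^B∣gen a u v a+u+v≡2r+1 refl with ℕ.+-cancelˡ-≡ (a + u) v (u + suc a) (trans (ℕ.+-assoc a u v) (trans a+u+v≡2r+1 (split a u)))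
    ... | refl = subst (λ m → 2 ^ B m ℕ.∣ 2 ^ suc a * binom u (u + suc a)) (trans (ℕ.+-suc u a) (cong suc (ℕ.+-comm u a)))
                       (2^B∣2^c*binom u (suc a))
    2^B∣T : + d ℤ.∣ T S (suc r)
    2^B∣T with empty-or-member S
    ... | inj₁ refl = subst (+ d ℤ.∣_) (sym (T-zeros-even r))
                        (∣m⇒∣-m (subst (+ d ℤ.∣_) (ℤ.pos-* 2 (binom r (suc r)))
                          (∣ᵤ⇒∣ (subst (λ m → 2 ^ B m ℕ.∣ 2 * binom r m) (ℕ.+-comm r 1) (2^B∣2^c*binom r 1)))))
    ... | inj₂ i    = subst (+ d ℤ.∣_) (sym (T-member S i (suc r))) (Span-binom-∣ d 2 r 2^B∣gen (K-Span (removeAt S (index i))))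

  2^B∣A : ∀ N S → + (2 ^ B (suc N)) ℤ.∣ A (suc N) S
  2^B∣A N S with parity N
  ... | even r = 2^B∣A-odd r S
  ... | odd r  = 2^B∣A-even r S

  e₁ : ∀ N → Vec Bool (suc N)
  e₁ N = true ∷ replicate N false

  IsVal₂-A-e₁-odd : ∀ r → IsVal₂ ∣ A (suc (2 * r)) (e₁ (2 * r)) ∣ (B (suc (2 * r)))
  IsVal₂-A-e₁-odd r = subst₂ (λ z k → IsVal₂ ∣ z ∣ k) (sym A≡) (sym (B-double+1 r)) (IsVal₂-2*binom[r,r] r)
    where
    A≡ : A (suc (2 * r)) (e₁ (2 * r)) ≡ + (2 * binom r r)
    A≡ = begin
      A (suc (2 * r)) (e₁ (2 * r))          ≡⟨ A≡T (majority-threshold-odd r) (e₁ (2 * r)) ⟩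
      T (e₁ (2 * r)) (suc r)                ≡⟨ T-member (e₁ (2 * r)) (here refl) (suc r) ⟩
      + 2 ℤ.* K (replicate (2 * r) false) r ≡⟨ cong (λ n → + 2 ℤ.* K (replicate (r + n) false) r) (ℕ.+-identityʳ r) ⟩
      + 2 ℤ.* K (replicate (r + r) false) r ≡⟨ cong (+ 2 ℤ.*_) (K-zeros-coeff r r) ⟩
      + 2 ℤ.* + binom r r                   ≡⟨ ℤ.pos-* 2 (binom r r) ⟨
      + (2 * binom r r)                     ∎

  IsVal₂-A-e₁-even : ∀ r → IsVal₂ ∣ A (2 + 2 * r) (e₁ (suc (2 * r))) ∣ (B (2 + 2 * r))
  IsVal₂-A-e₁-even r = subst₂ (λ z k → IsVal₂ ∣ z ∣ k) (sym A≡) (sym (B-2+2* r)) (IsVal₂-2*binom[r,1+r] r)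
    where
    A≡ : A (2 + 2 * r) (e₁ (suc (2 * r))) ≡ + (2 * binom r (suc r))
    A≡ = begin
      A (2 + 2 * r) (e₁ (suc (2 * r)))            ≡⟨ A≡T (majority-threshold-even r) (e₁ (suc (2 * r))) ⟩
      T (e₁ (suc (2 * r))) (suc r)                ≡⟨ T-member (e₁ (suc (2 * r))) (here refl) (suc r) ⟩
      + 2 ℤ.* K (replicate (suc (2 * r)) false) r ≡⟨ cong (λ n → + 2 ℤ.* K (replicate n false) r) (2r+1≡r+[1+r] r) ⟩
      + 2 ℤ.* K (replicate (r + suc r) false) r   ≡⟨ cong (+ 2 ℤ.*_) (K-zeros-coeff r (suc r)) ⟩
      + 2 ℤ.* + binom r (suc r)                   ≡⟨ ℤ.pos-* 2 (binom r (suc r)) ⟨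
      + (2 * binom r (suc r))                     ∎

  IsVal₂-A-e₁ : ∀ N → IsVal₂ ∣ A (suc N) (e₁ N) ∣ (B (suc N))
  IsVal₂-A-e₁ N with parity N
  ... | even r = IsVal₂-A-e₁-odd r
  ... | odd r  = IsVal₂-A-e₁-even r

module Granularity where
  open import Data.Nat as ℕ using (ℕ; zero; suc; _^_; _≤_; _∸_; z≤n)
  import Data.Nat.Properties as ℕ
  open import Data.Nat.Properties using (m^n≢0)
  import Data.Nat.Divisibility as ℕ
  open import Data.Integer as ℤ using (ℤ; +_; +[1+_]; -[1+_]; 0ℤ; ∣_∣)
  import Data.Integer.Properties as ℤ
  open import Data.Integer.Divisibility.Signed using (_∣_; divides; ∣ᵤ⇒∣; ∣⇒∣ᵤ)
  open import Data.Rational as ℚ using (ℚ)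
  import Data.Rational.Properties as ℚ
  open import Data.Rational.Unnormalised as ℚᵘ using (mkℚᵘ; *≡*; _≃_)
  import Data.Rational.Unnormalised.Properties as ℚᵘ
  open import Data.Product using (∃; _×_; _,_)
  open import Function.Bundles using (_⇔_; mk⇔; Equivalence)
  open import Relation.Nullary using (¬_)
  open import Relation.Binary.PropositionalEquality
  open TwoAdic using (IsVal₂; IsVal₂-*; IsVal₂-2^; IsVal₂⇒∣; IsVal₂-maximal; IsVal₂-exists; ≤⇒2^∣2^)

  _/2^_ : ℤ → ℕ → ℚ
  z /2^ n = (z ℚ./ 2 ^ n) {{m^n≢0 2 n}}

  toℚᵘ-/ : ∀ z d → ℚ.toℚᵘ (z ℚ./ suc d) ≃ mkℚᵘ z d
  toℚᵘ-/ z d = ℚ.toℚᵘ-fromℚᵘ (mkℚᵘ z d)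

  toℚᵘ-scaled : ∀ c z d → ℚ.toℚᵘ ((+ c ℚ./ 1) ℚ.* (z ℚ./ suc d)) ≃ mkℚᵘ (+ c ℤ.* z) d
  toℚᵘ-scaled c z d = ℚᵘ.≃-trans (ℚ.toℚᵘ-homo-* (+ c ℚ./ 1) (z ℚ./ suc d))
    (ℚᵘ.≃-trans (ℚᵘ.*-cong (toℚᵘ-/ (+ c) 0) (toℚᵘ-/ z d))
                (*≡* (cong (λ m → (+ c ℤ.* z) ℤ.* + suc m) (sym (ℕ.+-identityʳ d)))))

  IsInteger-scaled⇔∣ : ∀ c z d → IsInteger ((+ c ℚ./ 1) ℚ.* (z ℚ./ suc d)) ⇔ (+ suc d ∣ + c ℤ.* z)
  IsInteger-scaled⇔∣ c z d = mk⇔ to from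
    where
    to : IsInteger ((+ c ℚ./ 1) ℚ.* (z ℚ./ suc d)) → + suc d ∣ + c ℤ.* z
    to (w , eq) with ℚᵘ.≃-trans (ℚᵘ.≃-sym (toℚᵘ-scaled c z d)) (ℚᵘ.≃-trans (ℚᵘ.≃-reflexive (cong ℚ.toℚᵘ eq)) (toℚᵘ-/ w 0))
    ... | *≡* cz*1≡w*[1+d] = divides w (trans (sym (ℤ.*-identityʳ _)) cz*1≡w*[1+d])
    from : + suc d ∣ + c ℤ.* z → IsInteger ((+ c ℚ./ 1) ℚ.* (z ℚ./ suc d))
    from (divides w cz≡w*[1+d]) = w , ℚ.toℚᵘ-injective
      (ℚᵘ.≃-trans (toℚᵘ-scaled c z d) (ℚᵘ.≃-trans (*≡* (trans (ℤ.*-identityʳ _) cz≡w*[1+d])) (ℚᵘ.≃-sym (toℚᵘ-/ w 0))))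

  IsInteger-2^*/2^⇔∣ : ∀ k n z → IsInteger ((+ (2 ^ k) ℚ./ 1) ℚ.* (z /2^ n)) ⇔ (+ (2 ^ n) ∣ + (2 ^ k) ℤ.* z)
  IsInteger-2^*/2^⇔∣ k n z =
    subst₂ (λ q m → IsInteger ((+ (2 ^ k) ℚ./ 1) ℚ.* q) ⇔ (+ m ∣ + (2 ^ k) ℤ.* z))
           (sym (ℚ./-cong {z} {2 ^ n} {z} {suc d} {{m^n≢0 2 n}} refl 2^n≡1+d)) (sym 2^n≡1+d) (IsInteger-scaled⇔∣ (2 ^ k) z d)
    where
    d = ℕ.pred (2 ^ n)
    2^n≡1+d : 2 ^ n ≡ suc d
    2^n≡1+d = sym (ℕ.suc-pred (2 ^ n) {{m^n≢0 2 n}})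

  IsGran-/2^-0 : ∀ n → IsGran (0ℤ /2^ n) 0
  IsGran-/2^-0 n = Equivalence.from (IsInteger-2^*/2^⇔∣ 0 n 0ℤ) (divides 0ℤ refl) , λ _ ()

  IsGran-/2^ : ∀ n z {e} → IsVal₂ ∣ z ∣ e → IsGran (z /2^ n) (n ∸ e)
  IsGran-/2^ n z {e} v = Equivalence.from (IsInteger-2^*/2^⇔∣ (n ∸ e) n z) (∣ᵤ⇒∣ 2^n∣) , minimal
    where
    scaled : ∀ j → IsVal₂ ∣ + (2 ^ j) ℤ.* z ∣ (j ℕ.+ e)
    scaled j = subst (λ m → IsVal₂ m (j ℕ.+ e)) (sym (ℤ.abs-* (+ (2 ^ j)) z)) (IsVal₂-* (IsVal₂-2^ j) v)
    2^n∣ : 2 ^ n ℕ.∣ ∣ + (2 ^ (n ∸ e)) ℤ.* z ∣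
    2^n∣ = ℕ.∣-trans (≤⇒2^∣2^ (subst (n ≤_) (ℕ.+-comm e (n ∸ e)) (ℕ.m≤n+m∸n n e))) (IsVal₂⇒∣ (scaled (n ∸ e)))
    minimal : ∀ j → j ℕ.< n ∸ e → ¬ IsInteger ((+ (2 ^ j) ℚ./ 1) ℚ.* (z /2^ n))
    minimal j j<n∸e integral = ℕ.<⇒≱ j<n∸e (ℕ.m≤n+o⇒m∸n≤o n e (subst (n ≤_) (ℕ.+-comm j e)
      (IsVal₂-maximal (scaled j) (∣⇒∣ᵤ (Equivalence.to (IsInteger-2^*/2^⇔∣ j n z) integral)))))

  IsGran-/2^-≤-IsVal₂ : ∀ n z k → + (2 ^ k) ∣ z → ∃ (IsVal₂ ∣ z ∣) → ∃ λ j → IsGran (z /2^ n) j × j ≤ n ∸ k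
  IsGran-/2^-≤-IsVal₂ n z k 2^k∣z (e , v) = n ∸ e , IsGran-/2^ n z v , ℕ.∸-monoʳ-≤ n (IsVal₂-maximal {k = k} v (∣⇒∣ᵤ 2^k∣z))

  IsGran-/2^-≤ : ∀ n z k → + (2 ^ k) ∣ z → ∃ λ j → IsGran (z /2^ n) j × j ≤ n ∸ k
  IsGran-/2^-≤ n (+ zero)     k _     = 0 , IsGran-/2^-0 n , z≤n
  IsGran-/2^-≤ n z@(+[1+ m ]) k 2^k∣z = IsGran-/2^-≤-IsVal₂ n z k 2^k∣z (IsVal₂-exists (suc m))
  IsGran-/2^-≤ n z@(-[1+ m ]) k 2^k∣z = IsGran-/2^-≤-IsVal₂ n z k 2^k∣z (IsVal₂-exists (suc m))

open import Data.Nat using (suc)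
open import Data.Product using (_,_)
open Majority using (A; 2^B∣A; e₁; IsVal₂-A-e₁)
open Granularity using (IsGran-/2^; IsGran-/2^-≤)

lemma9 : (n : ℕ) → 1 ≤ n → IsGranF n (MAJ n) (n ∸ B n)
lemma9 (suc N) _ =
  (λ S → IsGran-/2^-≤ (suc N) (A (suc N) S) (B (suc N)) (2^B∣A N S)) ,
  e₁ N , IsGran-/2^ (suc N) (A (suc N) (e₁ N)) (IsVal₂-A-e₁ N)
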